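{- Let $k\geq 1$ and let $\tau\in S_k(123,231)$ with $\tau\neq(k,k-1,\dots,1)$. Then: (i) there exist integers $m$ with $2\leq m\leq k+1$ and $r$ with $1\leq r\leq m-2$ such that $$\tau=(k,k-1,\dots,m,\;r,r-1,\dots,1,\;m-1,m-2,\dots,r+1),$$ where the initial decreasing run $k,k-1,\dots,m$ is empty when $m=k+1$; (ii) for all $n\geq k$, $$|S_n(123,231,\tau)|=(k-2)n-\frac{k(k-3)}{2}.$$
   Context: Permutations are written in one-line notation; $S_k$ is the set of permutations of $\{1,\dots,k\}$. A permutation $\alpha\in S_n$ contains a pattern $\beta\in S_j$ if some subsequence of $\alpha$ of length $j$ is order-isomorphic to $\beta$; otherwise $\alpha$ avoids $\beta$. $S_n(\beta^1,\dots,\beta^s)$ denotes the set of permutations in $S_n$ avoiding each of $\beta^1,\dots,\beta^s$. -}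

module Defs where

open import Data.Nat using (ℕ; zero; suc; _+_; _∸_; _<_)
open import Data.Fin using (Fin; cast)
open import Data.List using (List; []; _∷_; map; upTo; length; lookup; reverse)
open import Data.List.Relation.Binary.Permutation.Propositional using (_↭_)
open import Data.List.Relation.Binary.Sublist.Propositional using (_⊆_)
open import Data.List.Relation.Unary.Unique.Propositional using (Unique)
open import Data.List.Membership.Propositional using (_∈_)
open import Data.Product using (Σ; ∃; _×_)
open import Function.Bundles using (_⇔_)
open import Relation.Nullary using (¬_)
open import Relation.Binary.PropositionalEquality using (_≡_)

-- Permutations in one-line notation are lists of naturals.
-- [1 , 2 , … , n]
oneTo : ℕ → List ℕ
oneTo n = map suc (upTo n)

IsPerm : ℕ → List ℕ → Set
IsPerm n α = α ↭ oneTo n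

OrderIso : List ℕ → List ℕ → Set
OrderIso xs ys =
  Σ (length xs ≡ length ys) λ eq →
    ∀ (i j : Fin (length xs)) →
      (lookup xs i < lookup xs j) ⇔ (lookup ys (cast eq i) < lookup ys (cast eq j))

Contains : List ℕ → List ℕ → Set
Contains α β = ∃ λ ys → (ys ⊆ α) × OrderIso ys β

Avoids : List ℕ → List ℕ → Set
Avoids α β = ¬ Contains α β

-- decreasing run  hi, hi-1, …, lo   (empty when hi < lo)
desc : ℕ → ℕ → List ℕ
desc lo hi = reverse (map (lo +_) (upTo (suc hi ∸ lo)))

HasCard : (List ℕ → Set) → ℕ → Set
HasCard P c =
  Σ (List (List ℕ)) λ L → Unique L × (∀ xs → (xs ∈ L) ⇔ P xs) × (length L ≡ c)

p123 p231 : List ℕ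
p123 = 1 ∷ 2 ∷ 3 ∷ []
p231 = 2 ∷ 3 ∷ 1 ∷ []

-- Split α ∈ S_n(123, 231) at its maximum, α = L ++ n ∷ R.  If L is empty, recurse on R.  Otherwise L
-- lies below n and below R (w < v with v ∈ L, w ∈ R would give 231 with n), and L and n ∷ R are
-- decreasing (an ascent would give 123 with n, resp. with the head of L), so α = (l, …, 1, n, …, l+1).
-- Hence α is either n, …, 1 or threeRuns a b c = (a+b+c, …, b+c+1, b, …, 1, b+c, …, b+1), b, c ≥ 1.
-- For b₀, c₀ ≥ 1, threeRuns a b c contains threeRuns a₀ b₀ c₀ iff a₀ ≤ a, b₀ ≤ b and c₀ ≤ c: an
-- increasing relabelling maps the pattern onto suffixes of the three runs; conversely the number b c
-- of non-inversions and the number b of entries with a larger entry to their right are invariant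
-- under order isomorphism and fix the sizes of the three parts of an occurrence.  So besides n, …, 1
-- the avoiders of τ = threeRuns a₀ b₀ c₀ correspond to the C(n, 2) triples with a + b + c = n and
-- b, c ≥ 1, minus the C(n−k+2, 2) of them that dominate (a₀, b₀, c₀).
module Submission where

open import Defs
open import Data.Nat using (ℕ; zero; suc; _+_; _*_; _∸_; _≤_; _<_; _⊓_; z≤n; s≤s; s≤s⁻¹; _<?_; _≤?_; pred)
open import Data.Nat.Properties
open import Data.Nat.Tactic.RingSolver using (solve-∀)
open import Data.Fin using (zero; suc; cast)
open import Data.List using (List; []; _∷_; _++_; length; map; filter; lookup; reverse; upTo; applyUpTo; applyDownFrom)
open import Data.List.Properties
  using (map-upTo; reverse-applyUpTo; length-applyDownFrom; length-applyUpTo; length-++; length-map; map-++;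
         map-id; filter-none; filter-all; filter-accept; filter-reject; filter-++; ++-identityʳ)
open import Data.List.Relation.Unary.All as All using (All; []; _∷_)
import Data.List.Relation.Unary.All.Properties as Allₚ
open import Data.List.Relation.Unary.AllPairs as AllPairs using (AllPairs; []; _∷_)
import Data.List.Relation.Unary.AllPairs.Properties as AllPairsₚ
open import Data.List.Relation.Unary.Any using (here; there)
open import Data.List.Relation.Unary.Unique.Propositional using (Unique)
import Data.List.Relation.Unary.Unique.Propositional.Properties as Unique
open import Data.List.Relation.Binary.Pointwise using (Pointwise; []; _∷_)
open import Data.List.Membership.Propositional using (_∈_)
open import Data.List.Membership.Propositional.Properties
  using (∈-applyDownFrom⁺; ∈-applyDownFrom⁻; ∈-applyUpTo⁺; ∈-applyUpTo⁻; ∈-++⁻; ∈-++⁺ˡ; ∈-++⁺ʳ; ∈-∃++;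
         ∈-map⁺; ∈-map⁻; ∈-filter⁺; ∈-filter⁻)
open import Data.List.Membership.Propositional.Properties.WithK using (unique∧set⇒bag)
open import Data.List.Relation.Binary.BagAndSetEquality using (∼bag⇒↭)
open import Data.List.Relation.Binary.Sublist.Propositional as Sublist
  using (_⊆_; []; _∷_; _∷ʳ_; ⊆-refl; from∈; minimum)
open import Data.List.Relation.Binary.Sublist.Propositional.Properties
  using (++⁺; ++⁺ˡ; ++⁺ʳ; All-resp-⊆; length-mono-≤)
open import Data.List.Relation.Binary.Permutation.Propositional using (_↭_; ↭-refl; ↭-sym; ↭-trans; ↭⇒↭ₛ)
open import Data.List.Relation.Binary.Permutation.Propositional.Properties
  using (↭-reverse; ++-comm; ∈-resp-↭; drop-∷; ↭-empty-inv; ↭-length)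
import Data.List.Relation.Binary.Permutation.Propositional.Properties as ↭
open import Data.List.Relation.Binary.Permutation.Setoid.Properties using (Unique-resp-↭)
open import Data.Product using (Σ; ∃; ∃₂; _×_; _,_; proj₁; proj₂)
open import Data.Sum using (_⊎_; inj₁; inj₂)
open import Data.Empty using (⊥)
open import Function using (_∘_; id)
open import Function.Bundles using (_⇔_; mk⇔; Equivalence)
open Equivalence using (to; from)
open import Relation.Nullary using (¬_; yes; no; contradiction)
open import Relation.Nullary.Decidable using (_×-dec_)
open import Relation.Unary using (Pred; Decidable)
open import Relation.Unary.Properties using (∁?)
open import Relation.Binary.Definitions using (tri<; tri≈; tri>)
open import Relation.Binary.PropositionalEquality
  using (_≡_; _≢_; refl; sym; trans; cong; cong₂; subst; setoid; module ≡-Reasoning)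

Decreasing : List ℕ → Set
Decreasing = AllPairs (λ x y → y < x)

run : ℕ → ℕ → List ℕ
run b = applyDownFrom (b +_)

desc≡run : ∀ lo hi → desc lo hi ≡ run lo (suc hi ∸ lo)
desc≡run lo hi = begin
  reverse (map (lo +_) (upTo l))  ≡⟨ cong reverse (map-upTo (lo +_) l) ⟩
  reverse (applyUpTo (lo +_) l)   ≡⟨ reverse-applyUpTo (lo +_) l ⟩
  run lo l                        ∎
  where open ≡-Reasoning; l = suc hi ∸ lo

∈-run⁻ : ∀ {v} b l → v ∈ run b l → b ≤ v × v < b + l
∈-run⁻ b l p with i , i<l , refl ← ∈-applyDownFrom⁻ (b +_) p = m≤m+n b i , +-monoʳ-< b i<l

∈-run⁺ : ∀ {v} b l → b ≤ v → v < b + l → v ∈ run b l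
∈-run⁺ {v} b l b≤v v<b+l = subst (_∈ run b l) (m+[n∸m]≡n b≤v) (∈-applyDownFrom⁺ (b +_) v∸b<l)
  where
  v∸b<l : v ∸ b < l
  v∸b<l = +-cancelˡ-< b (v ∸ b) l (subst (_< b + l) (sym (m+[n∸m]≡n b≤v)) v<b+l)

run-≥ : ∀ b l → All (b ≤_) (run b l)
run-≥ b l = All.tabulate (proj₁ ∘ ∈-run⁻ b l)

run-< : ∀ b l → All (_< b + l) (run b l)
run-< b l = All.tabulate (proj₂ ∘ ∈-run⁻ b l)

run-decreasing : ∀ b l → Decreasing (run b l)
run-decreasing b l = AllPairsₚ.applyDownFrom⁺₁ (b +_) l (λ j<i _ → +-monoʳ-< b j<i)

length-run : ∀ b l → length (run b l) ≡ l
length-run b = length-applyDownFrom (b +_)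

run-++ : ∀ b l₁ l₂ → run b (l₁ + l₂) ≡ run (b + l₂) l₁ ++ run b l₂
run-++ b zero l₂ = refl
run-++ b (suc l₁) l₂ =
  cong₂ _∷_ (trans (cong (b +_) (+-comm l₁ l₂)) (sym (+-assoc b l₂ l₁))) (run-++ b l₁ l₂)

run-suffix : ∀ b {l₀ l} → l₀ ≤ l → run b l₀ ⊆ run b l
run-suffix b {l₀} {l} l₀≤l = subst (run b l₀ ⊆_) (sym split) (++⁺ˡ (run (b + l₀) (l ∸ l₀)) ⊆-refl)
  where
  split : run b l ≡ run (b + l₀) (l ∸ l₀) ++ run b l₀
  split = trans (cong (run b) (sym (m∸n+n≡m l₀≤l))) (run-++ b (l ∸ l₀) l₀)

≤-head : ∀ {x xs v} → All (_< x) xs → v ∈ x ∷ xs → v ≤ x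
≤-head _ (here refl) = ≤-refl
≤-head x>xs (there p) = <⇒≤ (All.lookup x>xs p)

∈-tail : ∀ {x xs ys v} → All (_< x) xs → (∀ {u} → u ∈ x ∷ xs → u ∈ x ∷ ys) → v ∈ xs → v ∈ ys
∈-tail x>xs sub p with sub (there p)
... | there q = q
... | here refl = contradiction (All.lookup x>xs p) (<-irrefl refl)

decreasing-≡ : ∀ {xs ys} → Decreasing xs → Decreasing ys → (∀ {v} → v ∈ xs ⇔ v ∈ ys) → xs ≡ ys
decreasing-≡ {[]} {[]} _ _ _ = refl
decreasing-≡ {[]} {_ ∷ _} _ _ xs≈ys with () ← from xs≈ys (here refl)
decreasing-≡ {_ ∷ _} {[]} _ _ xs≈ys with () ← to xs≈ys (here refl)
decreasing-≡ {x ∷ xs} {y ∷ ys} (x>xs ∷ dxs) (y>ys ∷ dys) xs≈ys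
  with refl ← ≤-antisym (≤-head y>ys (to xs≈ys (here refl))) (≤-head x>xs (from xs≈ys (here refl)))
  = cong (x ∷_) (decreasing-≡ dxs dys (mk⇔ (∈-tail x>xs (to xs≈ys)) (∈-tail y>ys (from xs≈ys))))

decreasing-≡-run : ∀ {xs} b l → Decreasing xs → (∀ {v} → v ∈ xs ⇔ (b ≤ v × v < b + l)) → xs ≡ run b l
decreasing-≡-run b l dxs xs≈ = decreasing-≡ dxs (run-decreasing b l)
  (mk⇔ (λ p → let b≤v , v<b+l = to xs≈ p in ∈-run⁺ b l b≤v v<b+l) (from xs≈ ∘ ∈-run⁻ b l))

allPairs-⊆ : ∀ {R : ℕ → ℕ → Set} {xs ys} → xs ⊆ ys → AllPairs R ys → AllPairs R xs
allPairs-⊆ [] [] = []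
allPairs-⊆ (y ∷ʳ xs⊆ys) (_ ∷ Rys) = allPairs-⊆ xs⊆ys Rys
allPairs-⊆ (refl ∷ xs⊆ys) (Ry ∷ Rys) = All-resp-⊆ xs⊆ys Ry ∷ allPairs-⊆ xs⊆ys Rys

allPairs-pair : ∀ {R : ℕ → ℕ → Set} {xs u v} → AllPairs R xs → (u ∷ v ∷ []) ⊆ xs → R u v
allPairs-pair Rxs s with (Ruv ∷ []) ∷ _ ← allPairs-⊆ s Rxs = Ruv

allPairs-fromPairs : ∀ {R : ℕ → ℕ → Set} {xs} →
                     (∀ {u v} → (u ∷ v ∷ []) ⊆ xs → R u v) → AllPairs R xs
allPairs-fromPairs {xs = []} _ = []
allPairs-fromPairs {xs = x ∷ xs} R-pairs =
  All.tabulate (λ v∈xs → R-pairs (refl ∷ from∈ v∈xs)) ∷ allPairs-fromPairs (R-pairs ∘ (x ∷ʳ_))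

⊆-++-split : ∀ (X : List ℕ) {Y ys} → ys ⊆ X ++ Y →
  ∃₂ λ ys₁ ys₂ → ys ≡ ys₁ ++ ys₂ × ys₁ ⊆ X × ys₂ ⊆ Y
⊆-++-split [] ys⊆Y = [] , _ , refl , [] , ys⊆Y
⊆-++-split (x ∷ X) (.x ∷ʳ ys⊆) with ys₁ , ys₂ , refl , ys₁⊆X , ys₂⊆Y ← ⊆-++-split X ys⊆ =
  ys₁ , ys₂ , refl , x ∷ʳ ys₁⊆X , ys₂⊆Y
⊆-++-split (x ∷ X) (refl ∷ ys⊆) with ys₁ , ys₂ , refl , ys₁⊆X , ys₂⊆Y ← ⊆-++-split X ys⊆ =
  x ∷ ys₁ , ys₂ , refl , refl ∷ ys₁⊆X , ys₂⊆Y

contains-∷ : ∀ {x α β} → Contains α β → Contains (x ∷ α) β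
contains-∷ (ys , ys⊆α , iso) = ys , _ ∷ʳ ys⊆α , iso

threeRuns : ℕ → ℕ → ℕ → List ℕ
threeRuns a b c = run (suc (b + c)) a ++ run 1 b ++ run (suc b) c

length-threeRuns : ∀ a b c → length (threeRuns a b c) ≡ a + (b + c)
length-threeRuns a b c = begin
  length (A ++ B ++ C)              ≡⟨ length-++ A ⟩
  length A + length (B ++ C)        ≡⟨ cong (length A +_) (length-++ B) ⟩
  length A + (length B + length C)  ≡⟨ cong₂ _+_ (length-run _ a) (cong₂ _+_ (length-run 1 b) (length-run _ c)) ⟩
  a + (b + c)                       ∎
  where
  open ≡-Reasoning
  A = run (suc (b + c)) a
  B = run 1 b
  C = run (suc b) c

middle<first : ∀ b c → All (_< suc (b + c)) (run 1 b ++ run (suc b) c)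
middle<first b c =
  Allₚ.++⁺ (All.map (λ v<1+b → <-≤-trans v<1+b (s≤s (m≤m+n b c))) (run-< 1 b)) (run-< (suc b) c)

Triple : Set
Triple = ℕ × ℕ × ℕ

total : Triple → ℕ
total (a , x , y) = a + x + y

runsOf : Triple → List ℕ
runsOf (a , x , y) = threeRuns a (suc x) (suc y)

both : ∀ {A B : Set} → A → B → A ⇔ B
both a b = mk⇔ (λ _ → b) (λ _ → a)

neither : ∀ {A B : Set} → ¬ A → ¬ B → A ⇔ B
neither ¬a ¬b = mk⇔ (λ a → contradiction a ¬a) (λ b → contradiction b ¬b)

<-irrefl⇔ : ∀ {m n : ℕ} → (m < m) ⇔ (n < n)
<-irrefl⇔ = neither (<-irrefl refl) (<-irrefl refl)

orderIso₃ : ∀ {x y z u v w : ℕ} →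
  (x < y ⇔ u < v) → (y < x ⇔ v < u) → (x < z ⇔ u < w) →
  (z < x ⇔ w < u) → (y < z ⇔ v < w) → (z < y ⇔ w < v) →
  OrderIso (x ∷ y ∷ z ∷ []) (u ∷ v ∷ w ∷ [])
orderIso₃ xy yx xz zx yz zy = refl , λ where
  zero zero → <-irrefl⇔
  zero (suc zero) → xy
  zero (suc (suc zero)) → xz
  (suc zero) zero → yx
  (suc zero) (suc zero) → <-irrefl⇔
  (suc zero) (suc (suc zero)) → yz
  (suc (suc zero)) zero → zx
  (suc (suc zero)) (suc zero) → zy
  (suc (suc zero)) (suc (suc zero)) → <-irrefl⇔

1<2 : 1 < 2
1<2 = s≤s (s≤s z≤n)

2<3 : 2 < 3
2<3 = s≤s 1<2

Has123 Has231 : List ℕ → Set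
Has123 α = ∃₂ λ x y → ∃ λ z → (x ∷ y ∷ z ∷ []) ⊆ α × x < y × y < z
Has231 α = ∃₂ λ x y → ∃ λ z → (x ∷ y ∷ z ∷ []) ⊆ α × x < y × z < x

contains-123⇔ : ∀ {α} → Contains α p123 ⇔ Has123 α
contains-123⇔ = mk⇔
  (λ { ((x ∷ y ∷ z ∷ []) , s , refl , iso) →
         x , y , z , s , from (iso zero (suc zero)) 1<2 , from (iso (suc zero) (suc (suc zero))) 2<3 })
  (λ { (x , y , z , s , x<y , y<z) →
         let x<z = <-trans x<y y<z ; 1<3 = <-trans 1<2 2<3 in
         _ , s , orderIso₃ (both x<y 1<2) (neither (<-asym x<y) (<-asym 1<2))
                           (both x<z 1<3) (neither (<-asym x<z) (<-asym 1<3))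
                           (both y<z 2<3) (neither (<-asym y<z) (<-asym 2<3)) })

contains-231⇔ : ∀ {α} → Contains α p231 ⇔ Has231 α
contains-231⇔ = mk⇔
  (λ { ((x ∷ y ∷ z ∷ []) , s , refl , iso) →
         x , y , z , s , from (iso zero (suc zero)) 2<3 , from (iso (suc (suc zero)) zero) 1<2 })
  (λ { (x , y , z , s , x<y , z<x) →
         let z<y = <-trans z<x x<y ; 1<3 = <-trans 1<2 2<3 in
         _ , s , orderIso₃ (both x<y 2<3) (neither (<-asym x<y) (<-asym 2<3))
                           (neither (<-asym z<x) (<-asym 1<2)) (both z<x 1<2)
                           (neither (<-asym z<y) (<-asym 1<3)) (both z<y 1<3) })

run-↭-oneTo : ∀ n → run 1 n ↭ oneTo n
run-↭-oneTo n = subst (_↭ oneTo n) (desc≡run 1 n) (↭-reverse (oneTo n))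

isPerm⇔↭run : ∀ {n α} → IsPerm n α ⇔ (α ↭ run 1 n)
isPerm⇔↭run {n} = mk⇔ (λ p → ↭-trans p (↭-sym (run-↭-oneTo n))) (λ p → ↭-trans p (run-↭-oneTo n))

decreasing⇒unique : ∀ {xs} → Decreasing xs → Unique xs
decreasing⇒unique = AllPairs.map (λ y<x x≡y → <-irrefl (sym x≡y) y<x)

↭run⇒unique : ∀ {n α} → α ↭ run 1 n → Unique α
↭run⇒unique {n} p = Unique-resp-↭ (setoid ℕ) (↭⇒↭ₛ (↭-sym p)) (decreasing⇒unique (run-decreasing 1 n))

∈-↭run : ∀ {n α v} → α ↭ run 1 n → v ∈ α ⇔ (1 ≤ v × v < suc n)
∈-↭run {n} p = mk⇔ (λ v∈α → ∈-run⁻ 1 n (∈-resp-↭ p v∈α))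
                   (λ (1≤v , v<1+n) → ∈-resp-↭ (↭-sym p) (∈-run⁺ 1 n 1≤v v<1+n))

threeRuns-↭ : ∀ a b c → threeRuns a b c ↭ run 1 (a + b + c)
threeRuns-↭ a b c = subst (threeRuns a b c ↭_) (sym split)
  (↭.++⁺ˡ (run (suc (b + c)) a) (++-comm (run 1 b) (run (suc b) c)))
  where
  split : run 1 (a + b + c) ≡ run (suc (b + c)) a ++ run (suc b) c ++ run 1 b
  split = begin
    run 1 (a + b + c)                     ≡⟨ cong (run 1) (trans (+-assoc a b c) (cong (a +_) (+-comm b c))) ⟩
    run 1 (a + (c + b))                   ≡⟨ run-++ 1 a (c + b) ⟩
    run (suc (c + b)) a ++ run 1 (c + b)  ≡⟨ cong₂ _++_ (cong (λ m → run (suc m) a) (+-comm c b)) (run-++ 1 c b) ⟩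
    run (suc (b + c)) a ++ run (suc b) c ++ run 1 b ∎
    where open ≡-Reasoning

decreasing-avoids-123 : ∀ {α} → Decreasing α → Avoids α p123
decreasing-avoids-123 dα c with _ , _ , _ , s , x<y , _ ← to contains-123⇔ c
  with (y<x ∷ _) ∷ _ ← allPairs-⊆ s dα = <-asym x<y y<x

decreasing-avoids-231 : ∀ {α} → Decreasing α → Avoids α p231
decreasing-avoids-231 dα c with _ , _ , _ , s , x<y , _ ← to contains-231⇔ c
  with (y<x ∷ _) ∷ _ ← allPairs-⊆ s dα = <-asym x<y y<x

ascent-avoids-prefix : ∀ {t X Y x y zs} → Decreasing X → All (t ≤_) X → All (_< t) Y →
  (x ∷ y ∷ zs) ⊆ X ++ Y → x < y → (x ∷ y ∷ zs) ⊆ Y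
ascent-avoids-prefix {X = []} _ _ _ s _ = s
ascent-avoids-prefix {X = _ ∷ _} (_ ∷ dX) (_ ∷ t≤X) Y<t (_ ∷ʳ s) x<y = ascent-avoids-prefix dX t≤X Y<t s x<y
ascent-avoids-prefix {X = _ ∷ X} (X<x ∷ _) (t≤x ∷ _) Y<t (refl ∷ s) x<y
  with ∈-++⁻ X (Sublist.lookup s (here refl))
... | inj₁ y∈X = contradiction (All.lookup X<x y∈X) (<-asym x<y)
... | inj₂ y∈Y = contradiction (<-≤-trans (All.lookup Y<t y∈Y) t≤x) (<-asym x<y)

threeRuns-ascent : ∀ a b c {x y z} → (x ∷ y ∷ z ∷ []) ⊆ threeRuns a b c → x < y → x < z × z < y
threeRuns-ascent a b c s x<y
  with ⊆-++-split (run 1 b) (ascent-avoids-prefix (run-decreasing _ a) (run-≥ _ a) (middle<first b c) s x<y)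
... | [] , _ , refl , _ , xyz⊆C with (y<x ∷ _) ∷ _ ← allPairs-⊆ xyz⊆C (run-decreasing _ c) =
  contradiction y<x (<-asym x<y)
... | _ ∷ [] , _ , refl , x⊆B , yz⊆C with (z<y ∷ []) ∷ _ ← allPairs-⊆ yz⊆C (run-decreasing _ c) =
  <-≤-trans (All.lookup (run-< 1 b) (Sublist.lookup x⊆B (here refl)))
            (All.lookup (run-≥ _ c) (Sublist.lookup yz⊆C (there (here refl)))) ,
  z<y
... | _ ∷ _ ∷ [] , _ , refl , xy⊆B , _ with (y<x ∷ _) ∷ _ ← allPairs-⊆ xy⊆B (run-decreasing 1 b) =
  contradiction y<x (<-asym x<y)
... | _ ∷ _ ∷ _ ∷ [] , _ , refl , xyz⊆B , _ with (y<x ∷ _) ∷ _ ← allPairs-⊆ xyz⊆B (run-decreasing 1 b) =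
  contradiction y<x (<-asym x<y)
... | _ ∷ _ ∷ _ ∷ _ ∷ _ , _ , () , _

threeRuns-avoids-123 : ∀ a b c → Avoids (threeRuns a b c) p123
threeRuns-avoids-123 a b c h with _ , _ , _ , s , x<y , y<z ← to contains-123⇔ h =
  <-asym y<z (proj₂ (threeRuns-ascent a b c s x<y))

threeRuns-avoids-231 : ∀ a b c → Avoids (threeRuns a b c) p231
threeRuns-avoids-231 a b c h with _ , _ , _ , s , x<y , z<x ← to contains-231⇔ h =
  <-asym z<x (proj₁ (threeRuns-ascent a b c s x<y))

ThreeRunsShaped : ℕ → List ℕ → Set
ThreeRunsShaped n α = Σ Triple λ t → 2 + total t ≡ n × α ≡ runsOf t

threeRuns-shaped : ∀ {n b c α} → 1 ≤ b → 1 ≤ c → b + c ≡ n → α ≡ run 1 b ++ run (suc b) c →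
  ThreeRunsShaped n α
threeRuns-shaped {b = suc x} {suc y} (s≤s z≤n) (s≤s z≤n) refl refl =
  (0 , x , y) , cong suc (sym (+-suc x y)) , refl

module MaxNotFirst {n l : ℕ} {L R : List ℕ} (perm : (l ∷ L) ++ n ∷ R ↭ run 1 n)
  (no123 : Avoids ((l ∷ L) ++ n ∷ R) p123) (no231 : Avoids ((l ∷ L) ++ n ∷ R) p231) where

  α : List ℕ
  α = (l ∷ L) ++ n ∷ R

  distinct : ∀ {u v} → (u ∷ v ∷ []) ⊆ α → u ≢ v
  distinct = allPairs-pair (↭run⇒unique perm)

  bounded : ∀ {v} → v ∈ α → 1 ≤ v × v ≤ n
  bounded v∈α with 1≤v , s≤s v≤n ← to (∈-↭run perm) v∈α = 1≤v , v≤n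

  left<max : ∀ {v} → v ∈ l ∷ L → v < n
  left<max v∈L =
    ≤∧≢⇒< (proj₂ (bounded (∈-++⁺ˡ v∈L))) (distinct (++⁺ (from∈ v∈L) (refl ∷ minimum R)))

  left<right : ∀ {v w} → v ∈ l ∷ L → w ∈ R → v < w
  left<right {v} {w} v∈L w∈R = ≤∧≢⇒< (≮⇒≥ w≮v) (distinct (++⁺ (from∈ v∈L) (n ∷ʳ from∈ w∈R)))
    where
    w≮v : ¬ w < v
    w≮v w<v = no231 (from contains-231⇔ (_ , _ , _ , ++⁺ (from∈ v∈L) (refl ∷ from∈ w∈R) , left<max v∈L , w<v))

  right<max : ∀ {w} → w ∈ R → w < n
  right<max w∈R = ≤∧≢⇒< (proj₂ (bounded (∈-++⁺ʳ (l ∷ L) (there w∈R))))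
                        (distinct (++⁺ˡ (l ∷ L) (refl ∷ from∈ w∈R)) ∘ sym)

  left-decreasing : Decreasing (l ∷ L)
  left-decreasing = allPairs-fromPairs λ uv⊆L →
    ≤∧≢⇒< (≮⇒≥ (λ u<v → no123 (from contains-123⇔ (_ , _ , _ , ++⁺ uv⊆L (refl ∷ minimum R) , u<v ,
                                                     left<max (Sublist.lookup uv⊆L (there (here refl)))))))
          (distinct (++⁺ʳ (n ∷ R) uv⊆L) ∘ sym)

  right-decreasing : Decreasing (n ∷ R)
  right-decreasing = All.tabulate right<max ∷ allPairs-fromPairs λ uw⊆R →
    ≤∧≢⇒< (≮⇒≥ (λ u<w → no123 (from contains-123⇔ (_ , _ , _ , ++⁺ (from∈ (here refl)) (n ∷ʳ uw⊆R) ,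
                                                     left<right (here refl) (Sublist.lookup uw⊆R (here refl)) , u<w))))
          (distinct (++⁺ˡ (l ∷ L) (n ∷ʳ uw⊆R)) ∘ sym)

  left≤head : ∀ {v} → v ∈ l ∷ L → v ≤ l
  left≤head with L<l ∷ _ ← left-decreasing = ≤-head L<l

  left≡run : l ∷ L ≡ run 1 l
  left≡run = decreasing-≡-run 1 l left-decreasing (mk⇔ into onto)
    where
    into : ∀ {v} → v ∈ l ∷ L → 1 ≤ v × v < 1 + l
    into v∈L = proj₁ (bounded (∈-++⁺ˡ v∈L)) , s≤s (left≤head v∈L)
    onto : ∀ {v} → 1 ≤ v × v < 1 + l → v ∈ l ∷ L
    onto (1≤v , v<1+l)
      with ∈-++⁻ (l ∷ L) (from (∈-↭run perm) (1≤v , <-≤-trans v<1+l (m≤n⇒m≤1+n (left<max (here refl)))))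
    ... | inj₁ v∈L = v∈L
    ... | inj₂ (here refl) = contradiction (left<max (here refl)) (<⇒≱ v<1+l)
    ... | inj₂ (there v∈R) = contradiction (left<right (here refl) v∈R) (<⇒≱ v<1+l)

  right≡run : n ∷ R ≡ run (suc l) (n ∸ l)
  right≡run = decreasing-≡-run (suc l) (n ∸ l) right-decreasing (mk⇔ into onto)
    where
    top : suc l + (n ∸ l) ≡ suc n
    top = cong suc (m+[n∸m]≡n (<⇒≤ (left<max (here refl))))
    into : ∀ {v} → v ∈ n ∷ R → suc l ≤ v × v < suc l + (n ∸ l)
    into (here refl) = left<max (here refl) , subst (n <_) (sym top) ≤-refl
    into {v} (there v∈R) = left<right (here refl) v∈R , subst (v <_) (sym top) (m<n⇒m<1+n (right<max v∈R))
    onto : ∀ {v} → suc l ≤ v × v < suc l + (n ∸ l) → v ∈ n ∷ R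
    onto {v} (l<v , v<top)
      with ∈-++⁻ (l ∷ L) (from (∈-↭run perm) (≤-trans (s≤s z≤n) l<v , subst (v <_) top v<top))
    ... | inj₁ v∈L = contradiction l<v (≤⇒≯ (left≤head v∈L))
    ... | inj₂ v∈nR = v∈nR

  shaped : ThreeRunsShaped n α
  shaped = threeRuns-shaped (proj₁ (bounded (∈-++⁺ˡ {ys = n ∷ R} (here refl))))
                            (m<n⇒0<n∸m (left<max (here refl)))
                            (m+[n∸m]≡n (<⇒≤ (left<max (here refl))))
                            (cong₂ _++_ left≡run right≡run)

classify : ∀ n {α} → α ↭ run 1 n → Avoids α p123 → Avoids α p231 → α ≡ run 1 n ⊎ ThreeRunsShaped n α
classify zero p _ _ = inj₁ (↭-empty-inv p)
classify (suc n) p no123 no231 with ∈-∃++ (∈-resp-↭ (↭-sym p) (here refl))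
... | l ∷ L , R , refl = inj₂ (MaxNotFirst.shaped p no123 no231)
... | [] , R , refl with classify n (drop-∷ p) (no123 ∘ contains-∷) (no231 ∘ contains-∷)
...   | inj₁ refl = inj₁ refl
...   | inj₂ ((a , x , y) , refl , refl) =
  inj₂ ((suc a , x , y) , refl , cong (_∷ runsOf (a , x , y)) (top a x y))
  where top : ∀ a x y → suc (2 + (a + x + y)) ≡ suc (suc x + suc y) + a
        top = solve-∀

#above : ℕ → List ℕ → ℕ
#above x = length ∘ filter (x <?_)

-- f = id counts the non-inversions, f = (1 ⊓_) the entries that are not right-to-left maxima.
aboveSum : (ℕ → ℕ) → List ℕ → ℕ
aboveSum f [] = 0
aboveSum f (x ∷ xs) = f (#above x xs) + aboveSum f xs

data AscentsAgree : List ℕ → List ℕ → Set where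
  [] : AscentsAgree [] []
  _∷_ : ∀ {x y xs ys} → Pointwise (λ x′ y′ → (x < x′) ⇔ (y < y′)) xs ys →
        AscentsAgree xs ys → AscentsAgree (x ∷ xs) (y ∷ ys)

orderIso⇒ascentsAgree : ∀ xs ys → OrderIso xs ys → AscentsAgree xs ys
orderIso⇒ascentsAgree [] [] _ = []
orderIso⇒ascentsAgree (x ∷ xs) (y ∷ ys) (eq , iso) =
  head xs ys (cong pred eq) (λ i → iso zero (suc i)) ∷
  orderIso⇒ascentsAgree xs ys (cong pred eq , λ i j → iso (suc i) (suc j))
  where
  head : ∀ xs ys (eq : length xs ≡ length ys) →
         (∀ i → (x < lookup xs i) ⇔ (y < lookup ys (cast eq i))) →
         Pointwise (λ x′ y′ → (x < x′) ⇔ (y < y′)) xs ys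
  head [] [] _ _ = []
  head (_ ∷ xs) (_ ∷ ys) eq agree = agree zero ∷ head xs ys (cong pred eq) (agree ∘ suc)

#above-accept : ∀ {x x′ xs} → x < x′ → #above x (x′ ∷ xs) ≡ suc (#above x xs)
#above-accept x<x′ = cong length (filter-accept (_ <?_) x<x′)

#above-reject : ∀ {x x′ xs} → ¬ x < x′ → #above x (x′ ∷ xs) ≡ #above x xs
#above-reject x≮x′ = cong length (filter-reject (_ <?_) x≮x′)

#above-cong : ∀ {x y xs ys} → Pointwise (λ x′ y′ → (x < x′) ⇔ (y < y′)) xs ys → #above x xs ≡ #above y ys
#above-cong [] = refl
#above-cong {x} {y} (_∷_ {x′} {y′} x′≈y′ agree) with x <? x′
... | yes p = trans (#above-accept p) (trans (cong suc (#above-cong agree)) (sym (#above-accept (to x′≈y′ p))))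
... | no ¬p = trans (#above-reject ¬p) (trans (#above-cong agree) (sym (#above-reject (¬p ∘ from x′≈y′))))

aboveSum-cong : ∀ f {xs ys} → AscentsAgree xs ys → aboveSum f xs ≡ aboveSum f ys
aboveSum-cong f [] = refl
aboveSum-cong f (head ∷ tail) = cong₂ _+_ (cong f (#above-cong head)) (aboveSum-cong f tail)

#above-below : ∀ {x xs} → All (_< x) xs → #above x xs ≡ 0
#above-below xs<x = cong length (filter-none (_ <?_) (All.map <⇒≯ xs<x))

#above-above : ∀ {x xs} → All (x <_) xs → #above x xs ≡ length xs
#above-above x<xs = cong length (filter-all (_ <?_) x<xs)

#above-++ : ∀ x xs ys → #above x (xs ++ ys) ≡ #above x xs + #above x ys
#above-++ x xs ys = trans (cong length (filter-++ (x <?_) xs ys)) (length-++ (filter (x <?_) xs))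

aboveSum-prefix : ∀ f {t X Y} → f 0 ≡ 0 → Decreasing X → All (t ≤_) X → All (_< t) Y →
                  aboveSum f (X ++ Y) ≡ aboveSum f Y
aboveSum-prefix f f0 [] [] Y<t = refl
aboveSum-prefix f {t} {x ∷ X} {Y} f0 (X<x ∷ dX) (t≤x ∷ t≤X) Y<t = begin
  f (#above x (X ++ Y)) + aboveSum f (X ++ Y)  ≡⟨ cong (λ n → f n + _) (#above-below below) ⟩
  f 0 + aboveSum f (X ++ Y)                    ≡⟨ cong₂ _+_ f0 (aboveSum-prefix f f0 dX t≤X Y<t) ⟩
  aboveSum f Y                                 ∎
  where
  open ≡-Reasoning
  below : All (_< x) (X ++ Y)
  below = Allₚ.++⁺ X<x (All.map (λ y<t → <-≤-trans y<t t≤x) Y<t)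

aboveSum-decreasing : ∀ f {X} → f 0 ≡ 0 → Decreasing X → aboveSum f X ≡ 0
aboveSum-decreasing f {X} f0 dX =
  trans (cong (aboveSum f) (sym (++-identityʳ X))) (aboveSum-prefix f f0 dX (All.tabulate (λ _ → z≤n)) [])

aboveSum-below-above : ∀ f {t B C} → f 0 ≡ 0 → Decreasing B → Decreasing C →
                       All (_< t) B → All (t ≤_) C → aboveSum f (B ++ C) ≡ length B * f (length C)
aboveSum-below-above f f0 [] dC [] t≤C = aboveSum-decreasing f f0 dC
aboveSum-below-above f {t} {b ∷ B} {C} f0 (B<b ∷ dB) dC (b<t ∷ B<t) t≤C =
  cong₂ _+_ (cong f #above-b) (aboveSum-below-above f f0 dB dC B<t t≤C)
  where
  #above-b : #above b (B ++ C) ≡ length C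
  #above-b = begin
    #above b (B ++ C)        ≡⟨ #above-++ b B C ⟩
    #above b B + #above b C  ≡⟨ cong₂ _+_ (#above-below B<b) (#above-above (All.map (<-≤-trans b<t) t≤C)) ⟩
    length C                 ∎
    where open ≡-Reasoning

aboveSum-threeRuns-sublists : ∀ f {a b c A B C} → f 0 ≡ 0 →
  A ⊆ run (suc (b + c)) a → B ⊆ run 1 b → C ⊆ run (suc b) c →
  aboveSum f (A ++ B ++ C) ≡ length B * f (length C)
aboveSum-threeRuns-sublists f {a} {b} {c} f0 A⊆ B⊆ C⊆ =
  trans (aboveSum-prefix f f0 (allPairs-⊆ A⊆ (run-decreasing _ a)) (All-resp-⊆ A⊆ (run-≥ _ a))
                        (All-resp-⊆ (++⁺ B⊆ C⊆) (middle<first b c)))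
        (aboveSum-below-above f f0 (allPairs-⊆ B⊆ (run-decreasing 1 b)) (allPairs-⊆ C⊆ (run-decreasing _ c))
                              (All-resp-⊆ B⊆ (run-< 1 b)) (All-resp-⊆ C⊆ (run-≥ _ c)))

aboveSum-threeRuns : ∀ f a b c → f 0 ≡ 0 → aboveSum f (threeRuns a b c) ≡ b * f c
aboveSum-threeRuns f a b c f0 =
  trans (aboveSum-threeRuns-sublists f {a} {b} {c} f0 ⊆-refl ⊆-refl ⊆-refl)
        (cong₂ (λ m n → m * f n) (length-run 1 b) (length-run (suc b) c))

sizes-from-aboveSums : ∀ {p q b c} → p * (1 ⊓ q) ≡ suc b * 1 → p * q ≡ suc b * suc c →
  p ≡ suc b × q ≡ suc c
sizes-from-aboveSums {p} {zero} eq₁ _ with () ← trans (sym (*-zeroʳ p)) eq₁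
sizes-from-aboveSums {p} {suc q} {b} {c} eq₁ eq₂ =
  p≡1+b , *-cancelˡ-≡ (suc q) (suc c) (suc b) (trans (cong (_* suc q) (sym p≡1+b)) eq₂)
  where
  p≡1+b : p ≡ suc b
  p≡1+b = *-cancelʳ-≡ p (suc b) 1 eq₁

containment-bounds : ∀ {a b c a₀ b₀ c₀} → Contains (threeRuns a b c) (threeRuns a₀ (suc b₀) (suc c₀)) →
  a₀ ≤ a × suc b₀ ≤ b × suc c₀ ≤ c
containment-bounds {a} {b} {c} {a₀} {b₀} {c₀} (ys , ys⊆ , iso)
  with A , BC , refl , A⊆ , BC⊆ ← ⊆-++-split (run (suc (b + c)) a) ys⊆
  with B , C , refl , B⊆ , C⊆ ← ⊆-++-split (run 1 b) BC⊆ =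
  bound A⊆ (length-run _ a) |A|≡a₀ , bound B⊆ (length-run 1 b) |B|≡1+b₀ , bound C⊆ (length-run _ c) |C|≡1+c₀
  where
  τ = threeRuns a₀ (suc b₀) (suc c₀)
  same : ∀ f → f 0 ≡ 0 → length B * f (length C) ≡ suc b₀ * f (suc c₀)
  same f f0 = begin
    length B * f (length C)   ≡⟨ sym (aboveSum-threeRuns-sublists f {a} {b} {c} f0 A⊆ B⊆ C⊆) ⟩
    aboveSum f (A ++ B ++ C)  ≡⟨ aboveSum-cong f (orderIso⇒ascentsAgree (A ++ B ++ C) τ iso) ⟩
    aboveSum f τ              ≡⟨ aboveSum-threeRuns f a₀ (suc b₀) (suc c₀) f0 ⟩
    suc b₀ * f (suc c₀)       ∎
    where open ≡-Reasoning
  sizes : length B ≡ suc b₀ × length C ≡ suc c₀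
  sizes = sizes-from-aboveSums (same (1 ⊓_) refl) (same id refl)
  |B|≡1+b₀ : length B ≡ suc b₀
  |B|≡1+b₀ = proj₁ sizes
  |C|≡1+c₀ : length C ≡ suc c₀
  |C|≡1+c₀ = proj₂ sizes
  |A|≡a₀ : length A ≡ a₀
  |A|≡a₀ = +-cancelʳ-≡ (suc b₀ + suc c₀) (length A) a₀ (begin
    length A + (suc b₀ + suc c₀)      ≡⟨ cong (length A +_) (sym (cong₂ _+_ |B|≡1+b₀ |C|≡1+c₀)) ⟩
    length A + (length B + length C)  ≡⟨ cong (length A +_) (sym (length-++ B)) ⟩
    length A + length (B ++ C)        ≡⟨ sym (length-++ A) ⟩
    length (A ++ B ++ C)              ≡⟨ proj₁ iso ⟩
    length τ                          ≡⟨ length-threeRuns a₀ (suc b₀) (suc c₀) ⟩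
    a₀ + (suc b₀ + suc c₀)            ∎)
    where open ≡-Reasoning
  bound : ∀ {xs ys m n} → xs ⊆ ys → length ys ≡ n → length xs ≡ m → m ≤ n
  bound xs⊆ys refl refl = length-mono-≤ xs⊆ys

StrictlyIncreasing : (ℕ → ℕ) → Set
StrictlyIncreasing f = ∀ {x y} → x < y → f x < f y

strictlyIncreasing⇔ : ∀ {f} → StrictlyIncreasing f → ∀ {x y} → (f x < f y) ⇔ (x < y)
strictlyIncreasing⇔ {f} mono {x} {y} = mk⇔ reflect mono
  where
  reflect : f x < f y → x < y
  reflect fx<fy with <-cmp x y
  ... | tri< x<y _ _ = x<y
  ... | tri≈ _ refl _ = contradiction fx<fy (<-irrefl refl)
  ... | tri> _ _ y<x = contradiction (mono y<x) (<-asym fx<fy)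

lookup-map : ∀ (f : ℕ → ℕ) xs i → lookup (map f xs) i ≡ f (lookup xs (cast (length-map f xs) i))
lookup-map f (x ∷ xs) zero = refl
lookup-map f (x ∷ xs) (suc i) = lookup-map f xs i

orderIso-map : ∀ {f} → StrictlyIncreasing f → ∀ xs → OrderIso (map f xs) xs
orderIso-map {f} mono xs = length-map f xs , agree
  where
  agree : ∀ i j → (lookup (map f xs) i < lookup (map f xs) j) ⇔
                  (lookup xs (cast (length-map f xs) i) < lookup xs (cast (length-map f xs) j))
  agree i j rewrite lookup-map f xs i | lookup-map f xs j = strictlyIncreasing⇔ mono

contains-refl : ∀ α → Contains α α
contains-refl α = α , ⊆-refl , subst (λ xs → OrderIso xs α) (map-id α) (orderIso-map id α)

bump : ℕ → ℕ → ℕ → ℕ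
bump t d v with t <? v
... | yes _ = d + v
... | no _ = v

bump-above : ∀ {t} d {v} → t < v → bump t d v ≡ d + v
bump-above {t} d {v} t<v with t <? v
... | yes _ = refl
... | no t≮v = contradiction t<v t≮v

bump-below : ∀ {t} d {v} → v ≤ t → bump t d v ≡ v
bump-below {t} d {v} v≤t with t <? v
... | yes t<v = contradiction v≤t (<⇒≱ t<v)
... | no _ = refl

bump-increasing : ∀ t d → StrictlyIncreasing (bump t d)
bump-increasing t d {x} {y} x<y with t <? x | t <? y
... | yes _ | yes _ = +-monoʳ-< d x<y
... | yes t<x | no t≮y = contradiction (<-trans t<x x<y) t≮y
... | no _ | yes _ = <-≤-trans x<y (m≤n+m y d)
... | no _ | no _ = x<y

map-run : ∀ {f : ℕ → ℕ} b b′ l → (∀ i → i < l → f (b + i) ≡ b′ + i) → map f (run b l) ≡ run b′ l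
map-run b b′ zero _ = refl
map-run b b′ (suc l) f-shift =
  cong₂ _∷_ (f-shift l ≤-refl) (map-run b b′ l (λ i i<l → f-shift i (m<n⇒m<1+n i<l)))

dominated-contained : ∀ {a₀ b₀ c₀ a b c} → a₀ ≤ a → b₀ ≤ b → c₀ ≤ c →
  Contains (threeRuns a b c) (threeRuns a₀ b₀ c₀)
dominated-contained {a₀} {b₀} {c₀} {a} a₀≤a b₀≤b c₀≤c
  with δb , refl ← m≤n⇒∃[o]m+o≡n b₀≤b
  with δc , refl ← m≤n⇒∃[o]m+o≡n c₀≤c
  = map f τ , subst (_⊆ threeRuns a (b₀ + δb) (c₀ + δc)) (sym image) embedded , orderIso-map increasing τ
  where
  τ = threeRuns a₀ b₀ c₀
  t = b₀ + δb + c₀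
  -- f fixes the middle run of τ, lifts its last run by δb and its first run by δb + δc.
  f = bump t δc ∘ bump b₀ δb
  increasing : StrictlyIncreasing f
  increasing = bump-increasing t δc ∘ bump-increasing b₀ δb

  A₀ A B₀ C₀ C : List ℕ
  A₀ = run (suc (b₀ + c₀)) a₀
  A = run (suc (b₀ + δb + (c₀ + δc))) a₀
  B₀ = run 1 b₀
  C₀ = run (suc b₀) c₀
  C = run (suc (b₀ + δb)) c₀

  first-lifted : ∀ b₀ δb c₀ i → δb + (suc (b₀ + c₀) + i) ≡ suc (b₀ + δb + c₀) + i
  first-lifted = solve-∀
  first-lifted-twice : ∀ b₀ δb c₀ δc i →
                       δc + (δb + (suc (b₀ + c₀) + i)) ≡ suc (b₀ + δb + (c₀ + δc)) + i
  first-lifted-twice = solve-∀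
  last-lifted : ∀ b₀ δb i → δb + (suc b₀ + i) ≡ suc (b₀ + δb) + i
  last-lifted = solve-∀
  last-lifted′ : ∀ b₀ δb i → δb + (suc b₀ + i) ≡ b₀ + δb + suc i
  last-lifted′ = solve-∀

  imageA : map f A₀ ≡ A
  imageA = map-run _ _ a₀ λ i _ → begin
    f (suc (b₀ + c₀) + i)
      ≡⟨ cong (bump t δc) (bump-above δb (≤-trans (s≤s (m≤m+n b₀ c₀)) (m≤m+n _ i))) ⟩
    bump t δc (δb + (suc (b₀ + c₀) + i))
      ≡⟨ bump-above δc (≤-trans (m≤m+n _ i) (≤-reflexive (sym (first-lifted b₀ δb c₀ i)))) ⟩
    δc + (δb + (suc (b₀ + c₀) + i))
      ≡⟨ first-lifted-twice b₀ δb c₀ δc i ⟩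
    suc (b₀ + δb + (c₀ + δc)) + i
      ∎
    where open ≡-Reasoning

  imageB : map f B₀ ≡ B₀
  imageB = map-run 1 1 b₀ λ i i<b₀ → begin
    f (suc i)          ≡⟨ cong (bump t δc) (bump-below δb i<b₀) ⟩
    bump t δc (suc i)  ≡⟨ bump-below δc (≤-trans i<b₀ (≤-trans (m≤m+n b₀ δb) (m≤m+n _ c₀))) ⟩
    suc i              ∎
    where open ≡-Reasoning

  imageC : map f C₀ ≡ C
  imageC = map-run _ _ c₀ λ i i<c₀ → begin
    f (suc b₀ + i)
      ≡⟨ cong (bump t δc) (bump-above δb (s≤s (m≤m+n b₀ i))) ⟩
    bump t δc (δb + (suc b₀ + i))
      ≡⟨ bump-below δc (≤-trans (≤-reflexive (last-lifted′ b₀ δb i)) (+-monoʳ-≤ (b₀ + δb) i<c₀)) ⟩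
    δb + (suc b₀ + i)
      ≡⟨ last-lifted b₀ δb i ⟩
    suc (b₀ + δb) + i
      ∎
    where open ≡-Reasoning

  image : map f τ ≡ A ++ B₀ ++ C
  image = begin
    map f (A₀ ++ B₀ ++ C₀)              ≡⟨ map-++ f A₀ (B₀ ++ C₀) ⟩
    map f A₀ ++ map f (B₀ ++ C₀)        ≡⟨ cong (map f A₀ ++_) (map-++ f B₀ C₀) ⟩
    map f A₀ ++ map f B₀ ++ map f C₀    ≡⟨ cong₂ _++_ imageA (cong₂ _++_ imageB imageC) ⟩
    A ++ B₀ ++ C                        ∎
    where open ≡-Reasoning

  embedded : A ++ B₀ ++ C ⊆ threeRuns a (b₀ + δb) (c₀ + δc)
  embedded = ++⁺ (run-suffix _ a₀≤a) (++⁺ (run-suffix 1 b₀≤b) (run-suffix _ c₀≤c))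

pairAt : ℕ → ℕ → ℕ × ℕ
pairAt s i = i , s ∸ i

pairs : ℕ → List (ℕ × ℕ)
pairs s = applyUpTo (pairAt s) (suc s)

∈-pairs⁺ : ∀ {s x y} → x + y ≡ s → (x , y) ∈ pairs s
∈-pairs⁺ {x = x} {y} refl =
  subst (λ z → (x , z) ∈ pairs (x + y)) (m+n∸m≡n x y) (∈-applyUpTo⁺ (pairAt (x + y)) (s≤s (m≤m+n x y)))

∈-pairs⁻ : ∀ {s x y} → (x , y) ∈ pairs s → x + y ≡ s
∈-pairs⁻ {s} p with i , s≤s i≤s , refl ← ∈-applyUpTo⁻ (pairAt s) p = m+[n∸m]≡n i≤s

pairs-unique : ∀ s → Unique (pairs s)
pairs-unique s = Unique.applyUpTo⁺₁ (pairAt s) (suc s) (λ i<j _ → <⇒≢ i<j ∘ cong proj₁)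

length-pairs : ∀ s → length (pairs s) ≡ suc s
length-pairs s = length-applyUpTo (pairAt s) (suc s)

zeroFirst : ℕ × ℕ → Triple
zeroFirst p = 0 , p

sucFirst : Triple → Triple
sucFirst (a , p) = suc a , p

zeroFirst-injective : ∀ {p q} → zeroFirst p ≡ zeroFirst q → p ≡ q
zeroFirst-injective refl = refl

sucFirst-injective : ∀ {t u} → sucFirst t ≡ sucFirst u → t ≡ u
sucFirst-injective {_ , _} {_ , _} refl = refl

triples : ℕ → List Triple
triples zero = map zeroFirst (pairs 0)
triples (suc N) = map zeroFirst (pairs (suc N)) ++ map sucFirst (triples N)

∈-triples⁺ : ∀ {N a x y} → a + x + y ≡ N → (a , x , y) ∈ triples N
∈-triples⁺ {zero} {zero} eq = ∈-map⁺ zeroFirst (∈-pairs⁺ eq)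
∈-triples⁺ {suc N} {zero} eq = ∈-++⁺ˡ (∈-map⁺ zeroFirst (∈-pairs⁺ eq))
∈-triples⁺ {suc N} {suc a} eq =
  ∈-++⁺ʳ (map zeroFirst (pairs (suc N))) (∈-map⁺ sucFirst (∈-triples⁺ (suc-injective eq)))

∈-triples⁻ : ∀ {N a x y} → (a , x , y) ∈ triples N → a + x + y ≡ N
∈-triples⁻ {zero} p with _ , q , refl ← ∈-map⁻ zeroFirst p = ∈-pairs⁻ q
∈-triples⁻ {suc N} p with ∈-++⁻ (map zeroFirst (pairs (suc N))) p
... | inj₁ p₀ with _ , q , refl ← ∈-map⁻ zeroFirst p₀ = ∈-pairs⁻ q
... | inj₂ p₊ with _ , q , refl ← ∈-map⁻ sucFirst p₊ = cong suc (∈-triples⁻ q)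

triples-unique : ∀ N → Unique (triples N)
triples-unique zero = Unique.map⁺ zeroFirst-injective (pairs-unique 0)
triples-unique (suc N) =
  Unique.++⁺ (Unique.map⁺ zeroFirst-injective (pairs-unique (suc N)))
             (Unique.map⁺ sucFirst-injective (triples-unique N))
             (λ (p₀ , p₊) → first-components p₀ p₊)
  where
  first-components : ∀ {t} → t ∈ map zeroFirst (pairs (suc N)) → t ∈ map sucFirst (triples N) → ⊥
  first-components p₀ p₊ with _ , _ , refl ← ∈-map⁻ zeroFirst p₀ with _ , _ , () ← ∈-map⁻ sucFirst p₊

length-triples : ∀ N → 2 * length (triples N) ≡ suc N * suc (suc N)
length-triples zero = refl
length-triples (suc N) = begin
  2 * length (map zeroFirst (pairs (suc N)) ++ map sucFirst (triples N))
    ≡⟨ cong (2 *_) (length-++ (map zeroFirst (pairs (suc N)))) ⟩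
  2 * (length (map zeroFirst (pairs (suc N))) + length (map sucFirst (triples N)))
    ≡⟨ cong₂ (λ m n → 2 * (m + n)) (trans (length-map zeroFirst (pairs (suc N))) (length-pairs (suc N)))
                                   (length-map sucFirst (triples N)) ⟩
  2 * (suc (suc N) + length (triples N))
    ≡⟨ *-distribˡ-+ 2 (suc (suc N)) (length (triples N)) ⟩
  2 * suc (suc N) + 2 * length (triples N)
    ≡⟨ cong (2 * suc (suc N) +_) (length-triples N) ⟩
  2 * suc (suc N) + suc N * suc (suc N)
    ≡⟨ step N ⟩
  suc (suc N) * suc (suc (suc N))
    ∎
  where
  open ≡-Reasoning
  step : ∀ N → 2 * suc (suc N) + suc N * suc (suc N) ≡ suc (suc N) * suc (suc (suc N))
  step = solve-∀

unique-length : ∀ {a} {A : Set a} {xs ys : List A} → Unique xs → Unique ys →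
                (∀ {v} → v ∈ xs ⇔ v ∈ ys) → length xs ≡ length ys
unique-length xs! ys! xs≈ys = ↭-length (∼bag⇒↭ (unique∧set⇒bag xs! ys! xs≈ys))

module _ {a p} {A : Set a} {P : Pred A p} (P? : Decidable P) where

  length-filter-∁ : ∀ xs → length (filter P? xs) + length (filter (∁? P?) xs) ≡ length xs
  length-filter-∁ [] = refl
  length-filter-∁ (x ∷ xs) with P? x
  ... | yes _ = cong suc (length-filter-∁ xs)
  ... | no _ = trans (+-suc _ _) (cong suc (length-filter-∁ xs))

Dominates : Triple → Triple → Set
Dominates (a₀ , x₀ , y₀) (a , x , y) = a₀ ≤ a × x₀ ≤ x × y₀ ≤ y

dominates? : ∀ t₀ → Decidable (Dominates t₀)
dominates? (a₀ , x₀ , y₀) (a , x , y) = a₀ ≤? a ×-dec x₀ ≤? x ×-dec y₀ ≤? y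

dominates-antisym : ∀ {t u} → Dominates t u → Dominates u t → t ≡ u
dominates-antisym {_ , _ , _} {_ , _ , _} (a≤a′ , x≤x′ , y≤y′) (a′≤a , x′≤x , y′≤y) =
  cong₂ _,_ (≤-antisym a≤a′ a′≤a) (cong₂ _,_ (≤-antisym x≤x′ x′≤x) (≤-antisym y≤y′ y′≤y))

_⊕_ : Triple → Triple → Triple
(a , x , y) ⊕ (a′ , x′ , y′) = a + a′ , x + x′ , y + y′

⊕-cancelˡ : ∀ t₀ {t u} → t₀ ⊕ t ≡ t₀ ⊕ u → t ≡ u
⊕-cancelˡ (a₀ , x₀ , y₀) {a , x , y} {a′ , x′ , y′} eq =
  cong₂ _,_ (+-cancelˡ-≡ a₀ a a′ (cong proj₁ eq))
            (cong₂ _,_ (+-cancelˡ-≡ x₀ x x′ (cong (proj₁ ∘ proj₂) eq))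
                       (+-cancelˡ-≡ y₀ y y′ (cong (proj₂ ∘ proj₂) eq)))

total-⊕ : ∀ t₀ t → total (t₀ ⊕ t) ≡ total t₀ + total t
total-⊕ (a₀ , x₀ , y₀) (a , x , y) = regroup a₀ x₀ y₀ a x y
  where regroup : ∀ a₀ x₀ y₀ a x y → a₀ + a + (x₀ + x) + (y₀ + y) ≡ a₀ + x₀ + y₀ + (a + x + y)
        regroup = solve-∀

∈-dominated⁺ : ∀ t₀ {M t} → t ∈ triples M → t₀ ⊕ t ∈ filter (dominates? t₀) (triples (total t₀ + M))
∈-dominated⁺ t₀@(a₀ , x₀ , y₀) {M} {t@(a , x , y)} t∈ =
  ∈-filter⁺ (dominates? t₀) (∈-triples⁺ (trans (total-⊕ t₀ t) (cong (total t₀ +_) (∈-triples⁻ t∈))))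
            (m≤m+n a₀ a , m≤m+n x₀ x , m≤m+n y₀ y)

∈-dominated⁻ : ∀ t₀ {M t} → t ∈ filter (dominates? t₀) (triples (total t₀ + M)) →
               t ∈ map (t₀ ⊕_) (triples M)
∈-dominated⁻ t₀ {M} {a , x , y} t∈
  with t∈T , (a₀≤a , x₀≤x , y₀≤y) ← ∈-filter⁻ (dominates? t₀) {xs = triples (total t₀ + M)} t∈
  with a′ , refl ← m≤n⇒∃[o]m+o≡n a₀≤a
  with x′ , refl ← m≤n⇒∃[o]m+o≡n x₀≤x
  with y′ , refl ← m≤n⇒∃[o]m+o≡n y₀≤y
  = ∈-map⁺ (t₀ ⊕_) (∈-triples⁺ (+-cancelˡ-≡ (total t₀) (a′ + x′ + y′) M
                                 (trans (sym (total-⊕ t₀ (a′ , x′ , y′))) (∈-triples⁻ t∈T))))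

length-dominated : ∀ t₀ M → length (filter (dominates? t₀) (triples (total t₀ + M))) ≡ length (triples M)
length-dominated t₀ M = trans
  (unique-length (Unique.filter⁺ (dominates? t₀) (triples-unique (total t₀ + M)))
                 (Unique.map⁺ (⊕-cancelˡ t₀) (triples-unique M))
                 (mk⇔ (∈-dominated⁻ t₀) onto))
  (length-map (t₀ ⊕_) (triples M))
  where
  onto : ∀ {v} → v ∈ map (t₀ ⊕_) (triples M) → v ∈ filter (dominates? t₀) (triples (total t₀ + M))
  onto v∈ with t , t∈ , refl ← ∈-map⁻ (t₀ ⊕_) v∈ = ∈-dominated⁺ t₀ t∈

decreasing-avoids-runsOf : ∀ t {α} → Decreasing α → Avoids α (runsOf t)
decreasing-avoids-runsOf (a , b , c) dα (ys , ys⊆α , iso) = 0≢1+n (begin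
  0                                              ≡⟨ sym (aboveSum-decreasing (1 ⊓_) refl (allPairs-⊆ ys⊆α dα)) ⟩
  aboveSum (1 ⊓_) ys                             ≡⟨ aboveSum-cong (1 ⊓_) (orderIso⇒ascentsAgree ys τ iso) ⟩
  aboveSum (1 ⊓_) τ                              ≡⟨ aboveSum-threeRuns (1 ⊓_) a (suc b) (suc c) refl ⟩
  suc b * 1                                      ∎)
  where
  open ≡-Reasoning
  τ = threeRuns a (suc b) (suc c)

contains-runsOf⇔ : ∀ {t₀ t} → Contains (runsOf t) (runsOf t₀) ⇔ Dominates t₀ t
contains-runsOf⇔ {a₀ , x₀ , y₀} {a , x , y} = mk⇔
  (λ c → let a₀≤a , x₀<1+x , y₀<1+y = containment-bounds {a} {suc x} {suc y} {a₀} {x₀} {y₀} c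
         in a₀≤a , s≤s⁻¹ x₀<1+x , s≤s⁻¹ y₀<1+y)
  (λ (a₀≤a , x₀≤x , y₀≤y) → dominated-contained a₀≤a (s≤s x₀≤x) (s≤s y₀≤y))

runsOf-injective : ∀ {t u} → runsOf t ≡ runsOf u → t ≡ u
runsOf-injective {t} {u} eq = dominates-antisym
  (to contains-runsOf⇔ (subst (λ α → Contains α (runsOf t)) eq (contains-refl (runsOf t))))
  (to contains-runsOf⇔ (subst (λ α → Contains α (runsOf u)) (sym eq) (contains-refl (runsOf u))))

runsOf-isPerm : ∀ {N t} → t ∈ triples N → IsPerm (2 + N) (runsOf t)
runsOf-isPerm {N} {t@(a , x , y)} t∈ =
  from isPerm⇔↭run (subst (λ m → runsOf t ↭ run 1 m) size (threeRuns-↭ a (suc x) (suc y)))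
  where
  shift : ∀ a x y → a + suc x + suc y ≡ 2 + (a + x + y)
  shift = solve-∀
  size : a + suc x + suc y ≡ 2 + N
  size = trans (shift a x y) (cong (2 +_) (∈-triples⁻ t∈))

Avoider : ℕ → List ℕ → List ℕ → Set
Avoider n τ α = IsPerm n α × Avoids α p123 × Avoids α p231 × Avoids α τ

nonDominated : Triple → ℕ → List Triple
nonDominated t₀ N = filter (∁? (dominates? t₀)) (triples N)

avoiders : Triple → ℕ → List (List ℕ)
avoiders t₀ N = run 1 (2 + N) ∷ map runsOf (nonDominated t₀ N)

∈-avoiders : ∀ t₀ N {α} → α ∈ avoiders t₀ N ⇔ Avoider (2 + N) (runsOf t₀) α
∈-avoiders t₀ N = mk⇔ into onto
  where
  into : ∀ {α} → α ∈ avoiders t₀ N → Avoider (2 + N) (runsOf t₀) α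
  into (here refl) = from isPerm⇔↭run ↭-refl , decreasing-avoids-123 (run-decreasing 1 _) ,
                     decreasing-avoids-231 (run-decreasing 1 _) , decreasing-avoids-runsOf t₀ (run-decreasing 1 _)
  into (there α∈) with (a , x , y) , t∈ , refl ← ∈-map⁻ runsOf α∈
    with t∈T , ¬dom ← ∈-filter⁻ (∁? (dominates? t₀)) {xs = triples N} t∈ =
    runsOf-isPerm t∈T , threeRuns-avoids-123 a (suc x) (suc y) , threeRuns-avoids-231 a (suc x) (suc y) ,
    ¬dom ∘ to contains-runsOf⇔
  onto : ∀ {α} → Avoider (2 + N) (runsOf t₀) α → α ∈ avoiders t₀ N
  onto (perm , no123 , no231 , noτ) with classify (2 + N) (to isPerm⇔↭run perm) no123 no231
  ... | inj₁ refl = here refl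
  ... | inj₂ (t , refl , refl) =
    there (∈-map⁺ runsOf (∈-filter⁺ (∁? (dominates? t₀)) (∈-triples⁺ refl) (noτ ∘ from contains-runsOf⇔)))

avoiders-unique : ∀ t₀ N → Unique (avoiders t₀ N)
avoiders-unique t₀ N =
  All.tabulate (λ α∈ → run≢runsOf (∈-map⁻ runsOf α∈)) ∷
  Unique.map⁺ runsOf-injective (Unique.filter⁺ (∁? (dominates? t₀)) (triples-unique N))
  where
  run≢runsOf : ∀ {α} → (Σ Triple λ t → t ∈ nonDominated t₀ N × α ≡ runsOf t) → run 1 (2 + N) ≢ α
  run≢runsOf (t , _ , refl) eq = decreasing-avoids-runsOf t (run-decreasing 1 (2 + N))
    (subst (λ α → Contains α (runsOf t)) (sym eq) (contains-refl (runsOf t)))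

-- The count with both sides moved so that no subtraction occurs.
card-arithmetic : ∀ s M g d T T′ → d + g ≡ T → d ≡ T′ →
  2 * T ≡ suc (s + M) * suc (suc (s + M)) → 2 * T′ ≡ suc M * suc (suc M) →
  2 * suc g + 4 * (2 + (s + M)) + (2 + s) * (2 + s) ≡ 2 * (2 + s) * (2 + (s + M)) + 3 * (2 + s)
card-arithmetic s M g d _ _ refl refl |T| |T′| = +-cancelʳ-≡ (2 * d) _ _ (begin
  2 * suc g + P + Q + 2 * d                                       ≡⟨ regroup g d P Q ⟩
  2 + 2 * (d + g) + P + Q                                         ≡⟨ cong (λ z → 2 + z + P + Q) |T| ⟩
  2 + suc (s + M) * suc (suc (s + M)) + P + Q                     ≡⟨ expand s M ⟩
  R + suc M * suc (suc M)                                         ≡⟨ cong (λ z → R + z) (sym |T′|) ⟩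
  R + 2 * d                                                       ∎)
  where
  open ≡-Reasoning
  P = 4 * (2 + (s + M))
  Q = (2 + s) * (2 + s)
  R = 2 * (2 + s) * (2 + (s + M)) + 3 * (2 + s)
  regroup : ∀ g d P Q → 2 * suc g + P + Q + 2 * d ≡ 2 + 2 * (d + g) + P + Q
  regroup = solve-∀
  expand : ∀ s M → 2 + suc (s + M) * suc (suc (s + M)) + 4 * (2 + (s + M)) + (2 + s) * (2 + s) ≡
                   2 * (2 + s) * (2 + (s + M)) + 3 * (2 + s) + suc M * suc (suc M)
  expand = solve-∀

-- Imported only here: the constructor +_ makes the sections m +_ of ℕ above ambiguous.
open import Data.Integer using (+_) renaming (_*_ to _*ℤ_; _-_ to _-ℤ_; _+_ to _+ℤ_)
open import Data.Integer.Properties using (pos-+; pos-*)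
import Data.Integer.Tactic.RingSolver as ℤ-Solver

ℕ⇒ℤ-card : ∀ c k n → 2 * c + 4 * n + k * k ≡ 2 * k * n + 3 * k →
  (+ 2) *ℤ (+ c) ≡ (+ 2) *ℤ ((+ k) -ℤ (+ 2)) *ℤ (+ n) -ℤ (+ k) *ℤ ((+ k) -ℤ (+ 3))
ℕ⇒ℤ-card c k n eq = begin
  (+ 2) *ℤ C                        ≡⟨ add-sub ((+ 2) *ℤ C) S ⟩
  (+ 2) *ℤ C +ℤ S -ℤ S              ≡⟨ cong (_-ℤ S) lifted ⟩
  (+ 2) *ℤ K *ℤ N +ℤ (+ 3) *ℤ K -ℤ S  ≡⟨ rearrange N K ⟩
  (+ 2) *ℤ (K -ℤ (+ 2)) *ℤ N -ℤ K *ℤ (K -ℤ (+ 3)) ∎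
  where
  open ≡-Reasoning
  C = + c
  N = + n
  K = + k
  S = (+ 4) *ℤ N +ℤ K *ℤ K
  add-sub : ∀ X A → X ≡ X +ℤ A -ℤ A
  add-sub = ℤ-Solver.solve-∀
  rearrange : ∀ N K → (+ 2) *ℤ K *ℤ N +ℤ (+ 3) *ℤ K -ℤ ((+ 4) *ℤ N +ℤ K *ℤ K) ≡
                      (+ 2) *ℤ (K -ℤ (+ 2)) *ℤ N -ℤ K *ℤ (K -ℤ (+ 3))
  rearrange = ℤ-Solver.solve-∀
  assoc : ∀ X Y W → X +ℤ (Y +ℤ W) ≡ X +ℤ Y +ℤ W
  assoc = ℤ-Solver.solve-∀
  lifted : (+ 2) *ℤ C +ℤ S ≡ (+ 2) *ℤ K *ℤ N +ℤ (+ 3) *ℤ K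
  lifted = begin
    (+ 2) *ℤ C +ℤ ((+ 4) *ℤ N +ℤ K *ℤ K)
      ≡⟨ assoc ((+ 2) *ℤ C) ((+ 4) *ℤ N) (K *ℤ K) ⟩
    (+ 2) *ℤ C +ℤ (+ 4) *ℤ N +ℤ K *ℤ K
      ≡⟨ cong₂ _+ℤ_ (cong₂ _+ℤ_ (pos-* 2 c) (pos-* 4 n)) (pos-* k k) ⟨
    + (2 * c) +ℤ + (4 * n) +ℤ + (k * k)
      ≡⟨ cong (_+ℤ + (k * k)) (pos-+ (2 * c) (4 * n)) ⟨
    + (2 * c + 4 * n) +ℤ + (k * k)
      ≡⟨ pos-+ (2 * c + 4 * n) (k * k) ⟨
    + (2 * c + 4 * n + k * k)
      ≡⟨ cong +_ eq ⟩
    + (2 * k * n + 3 * k)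
      ≡⟨ pos-+ (2 * k * n) (3 * k) ⟩
    + (2 * k * n) +ℤ + (3 * k)
      ≡⟨ cong₂ _+ℤ_ (trans (pos-* (2 * k) n) (cong (_*ℤ N) (pos-* 2 k))) (pos-* 3 k) ⟩
    (+ 2) *ℤ K *ℤ N +ℤ (+ 3) *ℤ K
      ∎

avoiders-count : ∀ t₀ n → 2 + total t₀ ≤ n → let k = 2 + total t₀ in
  Σ ℕ λ c → HasCard (Avoider n (runsOf t₀)) c ×
    ((+ 2) *ℤ (+ c) ≡ (+ 2) *ℤ ((+ k) -ℤ (+ 2)) *ℤ (+ n) -ℤ (+ k) *ℤ ((+ k) -ℤ (+ 3)))
avoiders-count t₀ n k≤n with M , refl ← m≤n⇒∃[o]m+o≡n k≤n =
  length L , (L , avoiders-unique t₀ N , (λ _ → ∈-avoiders t₀ N) , refl) ,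
  ℕ⇒ℤ-card (length L) (2 + s) (2 + N)
    (card-arithmetic s M _ _ _ _ partition (length-dominated t₀ M) (length-triples N) (length-triples M))
  where
  s = total t₀
  N = s + M
  L = avoiders t₀ N
  partition : length (filter (dominates? t₀) (triples N)) + length (map runsOf (nonDominated t₀ N)) ≡
              length (triples N)
  partition = trans (cong (λ g → length (filter (dominates? t₀) (triples N)) + g)
                          (length-map runsOf (nonDominated t₀ N)))
                    (length-filter-∁ (dominates? t₀) (triples N))

runsOf-as-desc : ∀ t → let k = 2 + total t in
  Σ ℕ λ m → Σ ℕ λ r → 2 ≤ m × m ≤ k + 1 × 1 ≤ r × r ≤ m ∸ 2 ×
    runsOf t ≡ desc m k ++ desc 1 r ++ desc (r + 1) (m ∸ 1)
runsOf-as-desc (a , x , y) =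
  suc (b + c) , b , s≤s (s≤s z≤n) , subst (suc (b + c) ≤_) (top a x y) (m≤n+m _ a) , s≤s z≤n ,
  subst (b ≤_) (sym (+-suc x y)) (s≤s (m≤m+n x y)) ,
  sym (cong₂ _++_ (trans (desc≡run (suc (b + c)) k) (cong (run (suc (b + c))) first))
                  (cong₂ _++_ (desc≡run 1 b) (trans (desc≡run (b + 1) (b + c)) (cong₂ run (+-comm b 1) third))))
  where
  b = suc x
  c = suc y
  k = 2 + (a + x + y)
  top : ∀ a x y → a + suc (suc x + suc y) ≡ 2 + (a + x + y) + 1
  top = solve-∀
  size : ∀ a x y → 2 + (a + x + y) ≡ a + (suc x + suc y)
  size = solve-∀
  first : suc k ∸ suc (b + c) ≡ a
  first = trans (cong (_∸ (b + c)) (size a x y)) (m+n∸n≡m a (b + c))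
  third : suc (b + c) ∸ (b + 1) ≡ c
  third = trans (cong (suc (b + c) ∸_) (+-comm b 1)) (m+n∸m≡n b c)

theorem2 : (k : ℕ) → 1 ≤ k → (τ : List ℕ) → IsPerm k τ →
    Avoids τ p123 → Avoids τ p231 → τ ≢ desc 1 k →
    (Σ ℕ λ m → Σ ℕ λ r → 2 ≤ m × m ≤ k + 1 × 1 ≤ r × r ≤ m ∸ 2 ×
        τ ≡ desc m k ++ desc 1 r ++ desc (r + 1) (m ∸ 1))
    × ((n : ℕ) → k ≤ n →
        Σ ℕ λ c → HasCard (λ α → IsPerm n α × Avoids α p123 × Avoids α p231 × Avoids α τ) c
          × ((+ 2) *ℤ (+ c) ≡ (+ 2) *ℤ ((+ k) -ℤ (+ 2)) *ℤ (+ n) -ℤ (+ k) *ℤ ((+ k) -ℤ (+ 3))))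
theorem2 k _ τ τ-perm no123 no231 τ≢desc with classify k (to isPerm⇔↭run τ-perm) no123 no231
... | inj₁ refl = contradiction (sym (desc≡run 1 k)) τ≢desc
... | inj₂ (t , refl , refl) = runsOf-as-desc t , avoiders-count t
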